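{- Let $\pi$ be a permutation of $[n]$. Define a pile assignment $\rho^*:[n]\to\mathbb{N}$ and a type assignment $\tau^*$ jointly by: $\rho^*(1)=1$; for each $s\in[n-1]$ with $s=1$ or $\rho^*(s)>\rho^*(s-1)$ (i.e. $s$ begins a new pile), $\tau^*(\rho^*(s))=\mathrm{Q}$ if $\pi(s+1)>\pi(s)$ and $\tau^*(\rho^*(s))=\mathrm{S}$ if $\pi(s+1)<\pi(s)$; and $\rho^*(s+1)=\rho^*(s)+\big[\pi(s+1)\prec_{\tau^*(\rho^*(s))}\pi(s)\big]$ for $s\in[n-1]$ (the type of a pile beginning at $s=n$, if any, is arbitrary). Then $(\tau^*,\rho^*)$ is a minimal sort of $\pi$: it sorts $\pi$, and for every type assignment $\tau$ and pile assignment $\rho$ with $\rho(1)=1$ such that $(\tau,\rho)$ sorts $\pi$, we have $\rho(n)\ge\rho^*(n)$. Here $i\prec_{\mathrm{Q}} j\iff i<j$ and $i\prec_{\mathrm{S}} j\iff i>j$.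
   Context: A deck of cards labelled by $[n]$ is represented by a permutation $\pi$ of $[n]$ with $\pi(s)$ the position (from the top) of label $s$. Label $s$ is dealt to the $\rho(s)$-th pile collected; pile $p$ has type $\tau(p)\in\{\mathrm{Q},\mathrm{S}\}$ (queue preserves placement order, stack reverses it); the dealer may choose the types freely. With $\chi(p)=[\tau(p)=\mathrm{S}]$, the heterogeneous shuffle of $\pi$ with $(\tau,\rho)$ is the unique permutation $\sigma$ of $[n]$ with $\sigma(s)<\sigma(t)$ iff $\big(\rho(s),(-1)^{\chi(\rho(s))}\pi(s)\big)<\big(\rho(t),(-1)^{\chi(\rho(t))}\pi(t)\big)$ lexicographically; $(\tau,\rho)$ sorts $\pi$ if $\sigma$ is the identity. $[P]$ is the indicator of $P$. -}

module Defs where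

open import Data.Nat using (ℕ; zero; suc; _<_; _<ᵇ_; _≡ᵇ_; _<?_)
open import Data.Nat.Properties using ()
open import Data.Fin using (Fin; toℕ; fromℕ<)
open import Data.Fin.Permutation using (Permutation; _⟨$⟩ʳ_)
open import Data.Integer using (ℤ; +_; -_) renaming (_<_ to _<ℤ_)
open import Data.Bool using (Bool; true; false; if_then_else_)
open import Data.Product using (_×_; _,_; proj₁; proj₂)
open import Data.Sum using (_⊎_)
open import Data.List using (foldr; upTo)
open import Relation.Binary.PropositionalEquality using (_≡_)
open import Relation.Nullary using (yes; no)
open import Function.Bundles using (_⇔_)

data PileType : Set where
  Q S : PileType

-- Conventions: labels 1..n are Fin n (label s ↔ index s-1);
-- π ⟨$⟩ʳ s is the position of label s (0-indexed; only the order matters).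

signed : PileType → ℕ → ℤ
signed Q x = + x
signed S x = - (+ x)

key : ∀ {n} → Permutation n n → (ℕ → PileType) → (Fin n → ℕ) → Fin n → ℕ × ℤ
key π τ ρ s = ρ s , signed (τ (ρ s)) (toℕ (π ⟨$⟩ʳ s))

_<lex_ : ℕ × ℤ → ℕ × ℤ → Set
(a , x) <lex (b , y) = a < b ⊎ (a ≡ b × x <ℤ y)

-- (τ,ρ) sorts π: the heterogeneous shuffle σ is the identity, i.e. the identity
-- permutation is (the unique) σ with σ(s)<σ(t) iff key(s) <lex key(t).
Sorts : ∀ {n} → Permutation n n → (ℕ → PileType) → (Fin n → ℕ) → Set
Sorts {n} π τ ρ = (s t : Fin n) → (toℕ s < toℕ t) ⇔ (key π τ ρ s <lex key π τ ρ t)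

prec : PileType → ℕ → ℕ → Bool
prec Q i j = i <ᵇ j
prec S i j = j <ᵇ i

module Star {m : ℕ} (π : Permutation (suc m) (suc m)) (d : PileType) where
  -- position of 0-indexed label k (junk 0 outside range, never used in range)
  val : ℕ → ℕ
  val k with k <? suc m
  ... | yes p = toℕ (π ⟨$⟩ʳ fromℕ< p)
  ... | no _  = 0

  -- type of a pile beginning at 0-indexed label k; d for the last label
  startType : ℕ → PileType
  startType k with suc k <? suc m
  ... | yes _ = if val k <ᵇ val (suc k) then Q else S
  ... | no _  = d

  -- state k = (ρ*(k), τ*(ρ*(k)))  (0-indexed label k)
  state : ℕ → ℕ × PileType
  state zero = 1 , startType zero
  state (suc k) with state k
  ... | r , t = if prec t (val (suc k)) (val k) then (suc r , startType (suc k)) else (r , t)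

  ρ* : ℕ → ℕ
  ρ* k = proj₁ (state k)

  -- τ*(p): the type fixed when pile p was begun (first label k with ρ*(k) = p);
  -- d for piles never used (irrelevant)
  τ* : ℕ → PileType
  τ* p = foldr (λ k acc → if ρ* k ≡ᵇ p then proj₂ (state k) else acc) d (upTo (suc m))

{-# OPTIONS --safe #-}

-- Sorting means that the
-- keys (ρ(s), ±π(s)) increase along the labels, which the greedy rule guarantees step by step.
-- For minimality, let (τ, ρ) be any sort and a the label where the greedy pile of k begins; we
-- show ρ*(k) ≤ ρ(a).  At a greedy break after k we cannot have ρ(a) = ρ(k+1): the labels
-- a, …, k+1 would then share one ρ-pile, whose type is forced by the pair (a, a+1) to be the
-- greedy type, and the pair (k, k+1) respects that type, so the greedy rule would not break.
module Submission where

open import Defs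
open import Data.Bool using (Bool; true; false; if_then_else_; T)
open import Data.Bool.Properties using (T-≡)
open import Data.Fin using (Fin; zero; toℕ; fromℕ; fromℕ<)
open import Data.Fin.Properties
  using (toℕ-injective; toℕ<n; toℕ-fromℕ<; toℕ-fromℕ; fromℕ<-toℕ; fromℕ<-injective)
import Data.Fin.Properties as Finₚ
open import Data.Fin.Permutation using (Permutation; _⟨$⟩ʳ_)
open import Data.Integer using (ℤ; +<+) renaming (_<_ to _<ℤ_)
import Data.Integer.Properties as ℤ
open import Data.List using (List; _∷_; foldr)
open import Data.List.Membership.Propositional using (lose)
open import Data.List.Membership.Propositional.Properties using (∈-upTo⁺)
open import Data.List.Relation.Unary.Any using (Any; here; there)
open import Data.Nat
  using (ℕ; suc; _≤_; _<_; _≥_; _<ᵇ_; _≡ᵇ_; _<?_; _≤′_; ≤′-refl; ≤′-step; s≤s)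
open import Data.Nat.Properties
open import Data.Product using (_×_; _,_; proj₁; proj₂)
open import Data.Product.Relation.Binary.Lex.Strict using (×-transitive; ×-irreflexive)
open import Data.Sum using (inj₁; inj₂)
open import Function using (_∘_; _⇔_; mk⇔; Equivalence; Injection)
open import Function.Properties.Inverse using (↔⇒↣)
open import Relation.Binary.Core using (Rel)
open import Relation.Binary.Definitions using (Irreflexive; Transitive; tri<; tri≈; tri>)
open import Relation.Binary.PropositionalEquality
open import Relation.Nullary using (yes; no; ¬_; contradiction)
open import Relation.Nullary.Reflects using (Reflects; ofʸ; ofⁿ; fromEquivalence)

-- _<lex_ unfolds to ×-Lex _≡_ _<_ _<ℤ_, so the library's lexicographic lemmas apply.
<lex-trans : Transitive _<lex_
<lex-trans = ×-transitive {_≈₁_ = _≡_} {_<₁_ = _<_} {_<₂_ = _<ℤ_}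
  isEquivalence <-resp₂-≡ <-trans ℤ.<-trans

<lex-irrefl : Irreflexive _≡_ _<lex_
<lex-irrefl refl = ×-irreflexive {_≈₁_ = _≡_} {_<₁_ = _<_} {_≈₂_ = _≡_} {_<₂_ = _<ℤ_}
  <-irrefl ℤ.<-irrefl (refl , refl)

samePile-<lex : ∀ (τ : ℕ → PileType) {p q x y} → p ≡ q →
                (p , signed (τ p) x) <lex (q , signed (τ q) y) ⇔
                signed (τ p) x <ℤ signed (τ p) y
samePile-<lex τ refl = mk⇔ from-lex (λ x<y → inj₂ (refl , x<y))
  where
  from-lex : ∀ {p x y} → (p , x) <lex (p , y) → x <ℤ y
  from-lex (inj₁ p<p)        = contradiction p<p (<-irrefl refl)
  from-lex (inj₂ (_ , x<y)) = x<y

<lex⇒≤ : ∀ {p q x y} → (p , x) <lex (q , y) → p ≤ q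
<lex⇒≤ (inj₁ p<q)         = <⇒≤ p<q
<lex⇒≤ (inj₂ (refl , _)) = ≤-refl

strictMono⇒⇔ : ∀ {a ℓ} {A : Set a} {_≺_ : Rel A ℓ} →
               Irreflexive _≡_ _≺_ → Transitive _≺_ →
               ∀ {n} (f : Fin n → A) → (∀ {s t} → toℕ s < toℕ t → f s ≺ f t) →
               ∀ s t → (toℕ s < toℕ t) ⇔ (f s ≺ f t)
strictMono⇒⇔ {_≺_ = _≺_} irrefl trans f mono s t = mk⇔ mono reflect
  where
  reflect : f s ≺ f t → toℕ s < toℕ t
  reflect fs≺ft with Finₚ.<-cmp s t
  ... | tri< s<t _ _ = s<t
  ... | tri≈ _ refl _ = contradiction fs≺ft (irrefl refl)
  ... | tri> _ _ t<s = contradiction (trans fs≺ft (mono t<s)) (irrefl refl)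

consecutive⇒pairwise : ∀ {a ℓ} {A : Set a} {_≺_ : Rel A ℓ} → Transitive _≺_ →
                       ∀ {m} (f : ℕ → A) → (∀ {k} → k < m → f k ≺ f (suc k)) →
                       ∀ {i j} → i < j → j ≤ m → f i ≺ f j
consecutive⇒pairwise {_≺_ = _≺_} trans {m} f step i<j = go (≤⇒≤′ i<j)
  where
  go : ∀ {i j} → suc i ≤′ j → j ≤ m → f i ≺ f j
  go ≤′-refl        i<m = step i<m
  go (≤′-step i<′j) j<m = trans (go i<′j (<⇒≤ j<m)) (step j<m)

foldr-firstMatch : ∀ {a b} {A : Set a} {B : Set b} (p : A → Bool) (f : A → B)
                   {z c : B} {xs : List A} →
                   Any (T ∘ p) xs → (∀ {x} → T (p x) → f x ≡ c) →
                   foldr (λ x acc → if p x then f x else acc) z xs ≡ c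
foldr-firstMatch p f {xs = x ∷ _} match agree with p x in px
... | true = agree (Equivalence.from T-≡ px)
foldr-firstMatch p f (here  tpx)   agree | false = contradiction (subst T px tpx) λ ()
foldr-firstMatch p f (there match) agree | false = foldr-firstMatch p f match agree

extend : ∀ {a} {A : Set a} {n} → A → (Fin n → A) → ℕ → A
extend {n = n} z f k with k <? n
... | yes k<n = f (fromℕ< k<n)
... | no  _   = z

extend-fromℕ< : ∀ {a} {A : Set a} {n} {z : A} (f : Fin n → A) {k} (k<n : k < n) →
                extend z f k ≡ f (fromℕ< k<n)
extend-fromℕ< {n = n} f {k} k<n with k <? n
... | yes _   = refl
... | no  k≮n = contradiction k<n k≮n

extend-toℕ : ∀ {a} {A : Set a} {n} {z : A} (f : Fin n → A) (s : Fin n) →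
             extend z f (toℕ s) ≡ f s
extend-toℕ f s = trans (extend-fromℕ< f (toℕ<n s)) (cong f (fromℕ<-toℕ s (toℕ<n s)))

direction : ℕ → ℕ → PileType
direction x y = if x <ᵇ y then Q else S

prec-reflects : ∀ u i j → Reflects (signed u i <ℤ signed u j) (prec u i j)
prec-reflects Q i j = fromEquivalence (+<+ ∘ <ᵇ⇒< i j) (<⇒<ᵇ ∘ ℤ.drop‿+<+)
prec-reflects S i j =
  fromEquivalence (ℤ.neg-mono-< ∘ +<+ ∘ <ᵇ⇒< j i) (<⇒<ᵇ ∘ ℤ.drop‿+<+ ∘ ℤ.neg-cancel-<)

signed-≯⇒< : ∀ u {x y} → x ≢ y → ¬ signed u y <ℤ signed u x → signed u x <ℤ signed u y
signed-≯⇒< Q x≢y y≮x = +<+ (≤∧≢⇒< (≮⇒≥ (y≮x ∘ +<+)) x≢y)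
signed-≯⇒< S x≢y y≮x =
  ℤ.neg-mono-< (+<+ (≤∧≢⇒< (≮⇒≥ (y≮x ∘ ℤ.neg-mono-< ∘ +<+)) (x≢y ∘ sym)))

signed-<⇒direction : ∀ u {x y} → signed u x <ℤ signed u y → direction x y ≡ u
signed-<⇒direction Q {x} {y} x<y with x <ᵇ y | <ᵇ-reflects-< x y
... | true  | _       = refl
... | false | ofⁿ x≮y = contradiction (ℤ.drop‿+<+ x<y) x≮y
signed-<⇒direction S {x} {y} x>y with x <ᵇ y | <ᵇ-reflects-< x y
... | true  | ofʸ x<y = contradiction (ℤ.drop‿+<+ (ℤ.neg-cancel-< x>y)) (<-asym x<y)
... | false | _       = refl

module Greedy {m : ℕ} (π : Permutation (suc m) (suc m)) (d : PileType) where
  open Star π d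

  position : Fin (suc m) → ℕ
  position s = toℕ (π ⟨$⟩ʳ s)

  val≡extend : ∀ k → val k ≡ extend 0 position k
  val≡extend k with k <? suc m
  ... | yes _ = refl
  ... | no  _ = refl

  val-fromℕ< : ∀ {k} (k<1+m : k < suc m) → val k ≡ position (fromℕ< k<1+m)
  val-fromℕ< {k} k<1+m = trans (val≡extend k) (extend-fromℕ< position k<1+m)

  val-toℕ : ∀ s → val (toℕ s) ≡ position s
  val-toℕ s = trans (val≡extend (toℕ s)) (extend-toℕ position s)

  val-injective : ∀ {i j} → i < suc m → j < suc m → val i ≡ val j → i ≡ j
  val-injective {i} {j} i<1+m j<1+m vi≡vj = fromℕ<-injective i j i<1+m j<1+m
    (Injection.injective (↔⇒↣ π) (toℕ-injective
      (trans (sym (val-fromℕ< i<1+m)) (trans vi≡vj (val-fromℕ< j<1+m)))))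

  -- Keys indexed by ℕ rather than Fin, to follow the recursion of Star.state over ℕ.
  keyAt : (ℕ → PileType) → (ℕ → ℕ) → ℕ → ℕ × ℤ
  keyAt τ r k = r k , signed (τ (r k)) (val k)

  Increasing : (ℕ → PileType) → (ℕ → ℕ) → Set
  Increasing τ r = ∀ {i j} → i < j → j ≤ m → keyAt τ r i <lex keyAt τ r j

  Sorts⇔Increasing : ∀ τ {ρ r} → (∀ s → ρ s ≡ r (toℕ s)) → Sorts π τ ρ ⇔ Increasing τ r
  Sorts⇔Increasing τ {ρ} {r} ρ≗r = mk⇔ to from
    where
    key≡keyAt : ∀ s → key π τ ρ s ≡ keyAt τ r (toℕ s)
    key≡keyAt s = cong₂ (λ p x → p , signed (τ p) x) (ρ≗r s) (sym (val-toℕ s))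

    key-fromℕ< : ∀ {k} (k<1+m : k < suc m) → key π τ ρ (fromℕ< k<1+m) ≡ keyAt τ r k
    key-fromℕ< k<1+m = trans (key≡keyAt _) (cong (keyAt τ r) (toℕ-fromℕ< k<1+m))

    to : Sorts π τ ρ → Increasing τ r
    to sorts i<j j≤m = subst₂ _<lex_ (key-fromℕ< i<1+m) (key-fromℕ< (s≤s j≤m))
      (Equivalence.to (sorts _ _)
        (subst₂ _<_ (sym (toℕ-fromℕ< i<1+m)) (sym (toℕ-fromℕ< (s≤s j≤m))) i<j))
      where i<1+m = ≤-trans i<j (m≤n⇒m≤1+n j≤m)

    from : Increasing τ r → Sorts π τ ρ
    from increasing = strictMono⇒⇔ <lex-irrefl <lex-trans (key π τ ρ) λ {s} {t} s<t →
      subst₂ _<lex_ (sym (key≡keyAt s)) (sym (key≡keyAt t)) (increasing s<t (≤-pred (toℕ<n t)))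

  pileType : ℕ → PileType
  pileType k = proj₂ (state k)

  data Step (k : ℕ) : Set where
    newPile  : signed (pileType k) (val (suc k)) <ℤ signed (pileType k) (val k) →
               state (suc k) ≡ (suc (ρ* k) , startType (suc k)) → Step k
    samePile : ¬ signed (pileType k) (val (suc k)) <ℤ signed (pileType k) (val k) →
               state (suc k) ≡ state k → Step k

  step : ∀ k → Step k
  step k = from-reflects (prec-reflects (pileType k) (val (suc k)) (val k)) state-suc
    where
    from-reflects : ∀ {b} →
                    Reflects (signed (pileType k) (val (suc k)) <ℤ signed (pileType k) (val k)) b →
                    state (suc k) ≡ (if b then (suc (ρ* k) , startType (suc k)) else state k) →
                    Step k
    from-reflects (ofʸ descends) eq = newPile descends eq
    from-reflects (ofⁿ ascends)  eq = samePile ascends eq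

    state-suc : state (suc k) ≡ (if prec (pileType k) (val (suc k)) (val k)
                                 then (suc (ρ* k) , startType (suc k)) else state k)
    state-suc with state k
    ... | _ , _ = refl

  pileStart : ℕ → ℕ
  pileStart 0 = 0
  pileStart (suc k) with step k
  ... | newPile  _ _ = suc k
  ... | samePile _ _ = pileStart k

  pileStart≤ : ∀ k → pileStart k ≤ k
  pileStart≤ 0 = ≤-refl
  pileStart≤ (suc k) with step k
  ... | newPile  _ _ = ≤-refl
  ... | samePile _ _ = m≤n⇒m≤1+n (pileStart≤ k)

  pileType≡startType : ∀ k → pileType k ≡ startType (pileStart k)
  pileType≡startType 0 = refl
  pileType≡startType (suc k) with step k
  ... | newPile  _ eq = cong proj₂ eq
  ... | samePile _ eq = trans (cong proj₂ eq) (pileType≡startType k)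

  startType≡direction : ∀ {k} → k < m → startType k ≡ direction (val k) (val (suc k))
  startType≡direction {k} k<m with suc k <? suc m
  ... | yes k+1<1+m = cong (direction (val k)) (val-fromℕ< k+1<1+m)
  ... | no  k+1≮1+m = contradiction (s≤s k<m) k+1≮1+m

  ρ*-mono : ∀ {i j} → i ≤′ j → ρ* i ≤ ρ* j
  ρ*-mono ≤′-refl = ≤-refl
  ρ*-mono (≤′-step {j} i≤′j) with step j
  ... | newPile  _ eq =
    ≤-trans (ρ*-mono i≤′j) (≤-trans (n≤1+n _) (≤-reflexive (sym (cong proj₁ eq))))
  ... | samePile _ eq = ≤-trans (ρ*-mono i≤′j) (≤-reflexive (sym (cong proj₁ eq)))

  state-constant : ∀ {i j} → i ≤′ j → ρ* i ≡ ρ* j → state i ≡ state j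
  state-constant ≤′-refl _ = refl
  state-constant (≤′-step {j} i≤′j) ρ*i≡ρ*j+1 with step j
  ... | newPile  _ eq =
    contradiction (subst (_≤ ρ* j) (trans ρ*i≡ρ*j+1 (cong proj₁ eq)) (ρ*-mono i≤′j)) (<-irrefl refl)
  ... | samePile _ eq = trans (state-constant i≤′j (trans ρ*i≡ρ*j+1 (cong proj₁ eq))) (sym eq)

  pileType-cong : ∀ {i j} → ρ* i ≡ ρ* j → pileType i ≡ pileType j
  pileType-cong {i} {j} ρ*i≡ρ*j with ≤-total i j
  ... | inj₁ i≤j = cong proj₂ (state-constant (≤⇒≤′ i≤j) ρ*i≡ρ*j)
  ... | inj₂ j≤i = cong proj₂ (sym (state-constant (≤⇒≤′ j≤i) (sym ρ*i≡ρ*j)))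

  τ*-ρ* : ∀ {k} → k ≤ m → τ* (ρ* k) ≡ pileType k
  τ*-ρ* {k} k≤m = foldr-firstMatch (λ x → ρ* x ≡ᵇ ρ* k) pileType
    (lose (∈-upTo⁺ (s≤s k≤m)) (≡⇒≡ᵇ (ρ* k) (ρ* k) refl))
    (λ {x} → pileType-cong {x} {k} ∘ ≡ᵇ⇒≡ (ρ* x) (ρ* k))

  ρ*-key-step : ∀ {k} → k < m → keyAt τ* ρ* k <lex keyAt τ* ρ* (suc k)
  ρ*-key-step {k} k<m with step k
  ... | newPile  _ eq = inj₁ (≤-reflexive (sym (cong proj₁ eq)))
  ... | samePile ascends eq = Equivalence.from (samePile-<lex τ* (cong proj₁ (sym eq)))
    (subst (λ u → signed u (val k) <ℤ signed u (val (suc k))) (sym (τ*-ρ* (<⇒≤ k<m)))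
      (signed-≯⇒< (pileType k) (1+n≢n ∘ sym ∘ val-injective (m≤n⇒m≤1+n k<m) (s≤s k<m))
        ascends))

  ρ*-sorts : Sorts π τ* (λ s → ρ* (toℕ s))
  ρ*-sorts = Equivalence.from (Sorts⇔Increasing τ* {r = ρ*} (λ _ → refl))
    (consecutive⇒pairwise {_≺_ = _<lex_} <lex-trans (keyAt τ* ρ*) ρ*-key-step)

  module Minimality (τ : ℕ → PileType) (r : ℕ → ℕ) (increasing : Increasing τ r) where
    r-mono : ∀ {i j} → i ≤ j → j ≤ m → r i ≤ r j
    r-mono i≤j j≤m with m≤n⇒m<n∨m≡n i≤j
    ... | inj₁ i<j  = <lex⇒≤ (increasing i<j j≤m)
    ... | inj₂ refl = ≤-refl

    r-squeeze : ∀ {i j k} → i ≤ j → j ≤ k → k ≤ m → r i ≡ r k → r i ≡ r j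
    r-squeeze {j = j} i≤j j≤k k≤m ri≡rk =
      ≤-antisym (r-mono i≤j (≤-trans j≤k k≤m)) (subst (r j ≤_) (sym ri≡rk) (r-mono j≤k k≤m))

    samePile-ascends : ∀ {k} → k < m → r k ≡ r (suc k) →
                       signed (τ (r k)) (val k) <ℤ signed (τ (r k)) (val (suc k))
    samePile-ascends {k} k<m rk≡rk+1 =
      Equivalence.to (samePile-<lex τ rk≡rk+1) (increasing (n<1+n k) k<m)

    pileType≡τ : ∀ {k} → k < m → r (pileStart k) ≡ r (suc k) → pileType k ≡ τ (r k)
    pileType≡τ {k} k<m ra≡rk+1 = begin
      pileType k                      ≡⟨ pileType≡startType k ⟩
      startType a                     ≡⟨ startType≡direction a<m ⟩
      direction (val a) (val (suc a)) ≡⟨ signed-<⇒direction _ (samePile-ascends a<m ra≡ra+1) ⟩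
      τ (r a)                         ≡⟨ cong τ (r-squeeze a≤k (n≤1+n k) k<m ra≡rk+1) ⟩
      τ (r k)                         ∎
      where
      open ≡-Reasoning
      a = pileStart k
      a≤k = pileStart≤ k
      a<m = ≤-<-trans a≤k k<m
      ra≡ra+1 = r-squeeze (n≤1+n a) (s≤s a≤k) k<m ra≡rk+1

    newPile⇒r-increases : ∀ {k} → k < m →
                          signed (pileType k) (val (suc k)) <ℤ signed (pileType k) (val k) →
                          r (pileStart k) < r (suc k)
    newPile⇒r-increases {k} k<m descends =
      ≤∧≢⇒< (r-mono (m≤n⇒m≤1+n (pileStart≤ k)) k<m) λ ra≡rk+1 →
        ℤ.<-asym
          (subst (λ u → signed u (val (suc k)) <ℤ signed u (val k)) (pileType≡τ k<m ra≡rk+1) descends)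
          (samePile-ascends k<m (trans (sym (r-squeeze (pileStart≤ k) (n≤1+n k) k<m ra≡rk+1)) ra≡rk+1))

    ρ*≤r-pileStart : r 0 ≡ 1 → ∀ {k} → k ≤ m → ρ* k ≤ r (pileStart k)
    ρ*≤r-pileStart r0≡1 {0} _ = ≤-reflexive (sym r0≡1)
    ρ*≤r-pileStart r0≡1 {suc k} k<m with step k
    ... | newPile descends eq = subst (_≤ r (suc k)) (sym (cong proj₁ eq))
            (≤-<-trans (ρ*≤r-pileStart r0≡1 (<⇒≤ k<m)) (newPile⇒r-increases k<m descends))
    ... | samePile _ eq =
            subst (_≤ r (pileStart k)) (sym (cong proj₁ eq)) (ρ*≤r-pileStart r0≡1 (<⇒≤ k<m))

  ρ*-minimal : ∀ τ ρ → ρ zero ≡ 1 → Sorts π τ ρ → ρ* m ≤ ρ (fromℕ m)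
  ρ*-minimal τ ρ ρ0≡1 sorts = begin
    ρ* m                ≤⟨ ρ*≤r-pileStart (trans (extend-toℕ {z = 0} ρ zero) ρ0≡1) ≤-refl ⟩
    r (pileStart m)     ≤⟨ r-mono (pileStart≤ m) ≤-refl ⟩
    r m                 ≡⟨ cong r (toℕ-fromℕ m) ⟨
    r (toℕ (fromℕ m))   ≡⟨ extend-toℕ ρ (fromℕ m) ⟩
    ρ (fromℕ m)         ∎
    where
    open ≤-Reasoning
    r : ℕ → ℕ
    r = extend 0 ρ
    open Minimality τ r (Equivalence.to (Sorts⇔Increasing τ (sym ∘ extend-toℕ ρ)) sorts)

lemma9 : (m : ℕ) (π : Permutation (suc m) (suc m)) (d : PileType) →
    Sorts π (Star.τ* π d) (λ s → Star.ρ* π d (toℕ s))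
    × ((τ : ℕ → PileType) (ρ : Fin (suc m) → ℕ) → ρ zero ≡ 1 → Sorts π τ ρ →
       ρ (fromℕ m) ≥ Star.ρ* π d m)
lemma9 m π d = ρ*-sorts , ρ*-minimal
  where open Greedy π d
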